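{- Let $M$ be a matroid on a finite set $E$ with a fixed linear order, and let $\prec$ be a linear extension of $\le_{ext/int}$ restricted to the nbc sets of $M$. For each nbc set $I$ of $M$, the restriction set of the facet $G(I)$ of $\Delta^{\mathrm{nbc}}_M$ in the shelling order given by $\prec$ is $z_I=\{z_e:e\in I\}$.
   Context: Activities: for $S\subseteq E$, $e\in E\setminus S$ is externally active w.r.t. $S$ if there is a circuit $\gamma\subseteq S\cup\{e\}$ of $M$ with $e=\max\gamma$; set $\operatorname{EA}(S)$. An element $i\in S$ is internally active w.r.t. $S$ if it is externally active w.r.t. $E\setminus S$ in the dual matroid $M^\perp$ (same order); set $\operatorname{IA}(S)$. Every independent set $I$ is uniquely $B\setminus Y$ with $B$ a basis ($B_I$) and $Y\subseteq\operatorname{IA}(B)$; internally related = same related basis. nbc sets: independent sets $I$ with $\operatorname{EA}(I)=\emptyset$ (equivalently, containing no circuit-minus-its-maximum). Order: $I\le_{ext/int}J$ iff either $I,J$ not internally related and $(I\setminus\operatorname{IA}(I))\cup\operatorname{EA}(I)\subseteq(J\setminus\operatorname{IA}(J))\cup\operatorname{EA}(J)$, or internally related and $I\subseteq J$. $\Delta^{\mathrm{nbc}}_M$: vertices $\{y_e,z_e:e\in E\}$, facets $G(I)=y_{B_I\setminus I}z_I$ for nbc sets $I$; linear extensions of $\le_{ext/int}$ on nbc sets order them as a shelling. Restriction set of $F_j$ in a shelling $F_1,\dots,F_s$: the unique $R_j\subseteq F_j$ such that for $A\subseteq F_j$, $R_j\subseteq A$ iff $A\not\subseteq F_i$ for all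 $i<j$. -}

module Defs where

open import Data.Nat using (ℕ; _<_)
open import Data.Fin using (Fin) renaming (_≤_ to _≤ᶠ_)
open import Data.Fin.Subset
  using (Subset; _∈_; _∉_; _⊆_; _∪_; _─_; _-_; ∁; ⁅_⁆; ⊥; ∣_∣)
open import Data.Product using (Σ; ∃; _×_; _,_)
open import Data.Sum using (_⊎_)
open import Relation.Nullary using (¬_; Dec)
open import Relation.Binary.PropositionalEquality using (_≡_; _≢_)

-- Matroids on the ground set E = Fin n, linearly ordered by the
-- usual order of Fin n.  Given by their independent sets.

record Matroid (n : ℕ) : Set₁ where
  field
    Indep        : Subset n → Set
    indep?       : (S : Subset n) → Dec (Indep S)
    indep-empty  : Indep ⊥
    indep-subset : ∀ {I J} → J ⊆ I → Indep I → Indep J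
    indep-aug    : ∀ {I J} → Indep I → Indep J → ∣ I ∣ < ∣ J ∣ →
                   ∃ λ x → x ∈ J × x ∉ I × Indep (I ∪ ⁅ x ⁆)

module _ {n : ℕ} where

  -- Generic notions relative to an "independence" predicate, so that they
  -- can be applied both to M and to its dual M^⊥.

  IsCircuit : (Subset n → Set) → Subset n → Set
  IsCircuit Ind C = ¬ Ind C × (∀ x → x ∈ C → Ind (C - x))

  IsBasis : (Subset n → Set) → Subset n → Set
  IsBasis Ind B = Ind B × (∀ x → x ∉ B → ¬ Ind (B ∪ ⁅ x ⁆))

  IsMax : Fin n → Subset n → Set
  IsMax e γ = e ∈ γ × (∀ x → x ∈ γ → x ≤ᶠ e)

  ExtActive : (Subset n → Set) → Subset n → Fin n → Set
  ExtActive Ind S e =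
    e ∉ S × ∃ λ γ → IsCircuit Ind γ × γ ⊆ (S ∪ ⁅ e ⁆) × IsMax e γ

  DualIndep : Matroid n → Subset n → Set
  DualIndep M S = ∃ λ B → IsBasis (Matroid.Indep M) B × S ⊆ ∁ B

  EA : Matroid n → Subset n → Fin n → Set
  EA M S e = ExtActive (Matroid.Indep M) S e

  IA : Matroid n → Subset n → Fin n → Set
  IA M S i = i ∈ S × ExtActive (DualIndep M) (∁ S) i

  RelBasis : Matroid n → Subset n → Subset n → Set
  RelBasis M I B =
    IsBasis (Matroid.Indep M) B × I ⊆ B × (∀ y → y ∈ (B ─ I) → IA M B y)

  IntRelated : Matroid n → Subset n → Subset n → Set
  IntRelated M I J = ∃ λ B → RelBasis M I B × RelBasis M J B

  InKey : Matroid n → Subset n → Fin n → Set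
  InKey M I e = (e ∈ I × ¬ IA M I e) ⊎ EA M I e

  _≤ext/int_ : {M : Matroid n} → Subset n → Subset n → Set
  _≤ext/int_ {M} I J =
      (¬ IntRelated M I J × (∀ e → InKey M I e → InKey M J e))
    ⊎ (IntRelated M I J × I ⊆ J)

  IsNBC : Matroid n → Subset n → Set
  IsNBC M I = Matroid.Indep M I × (∀ e → ¬ EA M I e)

  record IsLinExtNBC (M : Matroid n) (_≺_ : Subset n → Subset n → Set) : Set where
    field
      irrefl : ∀ I → IsNBC M I → ¬ (I ≺ I)
      trans  : ∀ I J K → IsNBC M I → IsNBC M J → IsNBC M K →
               I ≺ J → J ≺ K → I ≺ K
      total  : ∀ I J → IsNBC M I → IsNBC M J → I ≢ J → (I ≺ J) ⊎ (J ≺ I)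
      extends : ∀ I J → IsNBC M I → IsNBC M J → I ≢ J →
                _≤ext/int_ {M} I J → I ≺ J

  -- Faces of Δ^nbc_M: a set of vertices {y_e} ∪ {z_e} is encoded as a pair
  -- (Y , Z) of subsets of E (Y = indices of y-vertices, Z = of z-vertices).
  Face : Set
  Face = Subset n × Subset n

  _⊆F_ : Face → Face → Set
  (Y , Z) ⊆F (Y' , Z') = Y ⊆ Y' × Z ⊆ Z'

  -- The facet G(I) = y_{B_I ∖ I} z_I, given B = B_I.
  G : Subset n → Subset n → Face
  G B I = (B ─ I , I)

  InFacet : Matroid n → Face → Subset n → Set
  InFacet M A J = ∃ λ B → RelBasis M J B × A ⊆F G B J

  zFace : Subset n → Face
  zFace I = (⊥ , I)

  IsRestrictionSet : Matroid n → (Subset n → Subset n → Set) →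
                     Subset n → Subset n → Face → Set
  IsRestrictionSet M _≺_ B I R =
    R ⊆F G B I ×
    (∀ A → A ⊆F G B I →
       (R ⊆F A → ∀ J → IsNBC M J → J ≺ I → ¬ InFacet M A J) ×
       ((∀ J → IsNBC M J → J ≺ I → ¬ InFacet M A J) → R ⊆F A))

module Submission where

-- If z_I ⊆ A ⊆ G(J) then I ⊆ J, and for nbc sets I ⊆ J forces I ≤ext/int J, so G(J) is not
-- earlier than G(I). Conversely, if A ⊆ G(I) misses z_x for some x ∈ I, then A ⊆ G(I - x),
-- where I - x is again nbc and precedes I. The point is that B_I ∖ I ⊆ B_{I-x} ∖ (I - x):
-- B_{I-x} is B_I when x is internally active in B_I, and otherwise B_I - x + y for the
-- largest y that can be exchanged for x; every element of B_I ∖ I stays internally active.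

open import Data.Nat using (ℕ)
open import Data.Fin.Subset using (Subset)
open import Defs

open import Level using (Level)
open import Data.Nat using (suc; _≤_; _<_; s≤s)
open import Data.Nat.Properties
  using (≤-refl; ≤-reflexive; ≤-trans; <-trans; ≤-<-trans; <-≤-trans; <-irrefl; <-asym; ≮⇒≥; <⇒≱)
open import Data.Bool using () renaming (_≟_ to _≟ᵇ_)
open import Data.Bool.Properties using (T-≡)
open import Data.Empty using (⊥-elim)
open import Data.Fin using (Fin; zero; suc) renaming (_<_ to _<ᶠ_; _≤_ to _≤ᶠ_)
open import Data.Fin.Properties using (_≟_; _<?_; any?)
open import Data.Fin.Subset
open import Data.Fin.Subset.Properties
open import Data.Product using (∃; _×_; _,_; proj₁; proj₂)
open import Data.Sum using (_⊎_; inj₁; inj₂)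
import Data.Sum as Sum
open import Data.Vec using (_∷_; tabulate; here; there)
open import Data.Vec.Properties using (≡-dec; lookup∘tabulate; lookup⇒[]=; []=⇒lookup)
open import Function using (_∘_; Equivalence)
open import Relation.Nullary using (¬_; Dec; yes; no; contradiction; ¬?)
open import Relation.Nullary.Decidable
  using (_×-dec_; _⊎-dec_; isYes; toWitness; fromWitness; decidable-stable; ¬¬-excluded-middle)
open import Relation.Nullary.Negation using (¬¬-map)
open import Relation.Unary using (Pred; Decidable)
open import Relation.Binary.PropositionalEquality
  using (_≡_; _≢_; refl; sym; trans; cong; subst)

private variable
  ℓ : Level
  n : ℕ
  p q r : Subset n
  t u v w x y z : Fin n

x∈p─q⇒x∉q : ∀ (p q : Subset n) → x ∈ p ─ q → x ∉ q
x∈p─q⇒x∉q (_ ∷ p) (outside ∷ q) here        ()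
x∈p─q⇒x∉q (_ ∷ p) (_ ∷ q)       (there x∈) (there x∈q) = x∈p─q⇒x∉q p q x∈ x∈q

x∈p-y⁻ : x ∈ p - y → x ∈ p × x ≢ y
x∈p-y⁻ {p = p} {y = y} x∈ = p─q⊆p p ⁅ y ⁆ x∈ , x∉⁅y⁆⇒x≢y (x∈p─q⇒x∉q p ⁅ y ⁆ x∈)

x∈p∪⁅y⁆⁻ : x ∈ p ∪ ⁅ y ⁆ → x ∈ p ⊎ x ≡ y
x∈p∪⁅y⁆⁻ {p = p} {y = y} x∈ = Sum.map₂ (x∈⁅y⁆⇒x≡y y) (x∈p∪q⁻ p ⁅ y ⁆ x∈)

x∈p⇒x∈p∪⁅y⁆ : x ∈ p → x ∈ p ∪ ⁅ y ⁆
x∈p⇒x∈p∪⁅y⁆ x∈p = x∈p∪q⁺ (inj₁ x∈p)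

x∈p∪⁅x⁆ : x ∈ p ∪ ⁅ x ⁆
x∈p∪⁅x⁆ {x = x} = x∈p∪q⁺ (inj₂ (x∈⁅x⁆ x))

∣p∣≡1+∣p-x∣ : x ∈ p → ∣ p ∣ ≡ suc ∣ p - x ∣
∣p∣≡1+∣p-x∣ {p = _ ∷ p}       here        = cong suc (cong ∣_∣ (sym (p─⊥≡p p)))
∣p∣≡1+∣p-x∣ {p = inside ∷ _}  (there x∈p) = cong suc (∣p∣≡1+∣p-x∣ x∈p)
∣p∣≡1+∣p-x∣ {p = outside ∷ _} (there x∈p) = ∣p∣≡1+∣p-x∣ x∈p

∣p∪⁅x⁆∣≡1+∣p∣ : x ∉ p → ∣ p ∪ ⁅ x ⁆ ∣ ≡ suc ∣ p ∣
∣p∪⁅x⁆∣≡1+∣p∣ {x = zero}  {p = inside ∷ _}  x∉p = contradiction here x∉p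
∣p∪⁅x⁆∣≡1+∣p∣ {x = zero}  {p = outside ∷ p} _   = cong suc (cong ∣_∣ (∪-identityʳ p))
∣p∪⁅x⁆∣≡1+∣p∣ {x = suc x} {p = inside ∷ _}  x∉p = cong suc (∣p∪⁅x⁆∣≡1+∣p∣ (x∉p ∘ there))
∣p∪⁅x⁆∣≡1+∣p∣ {x = suc x} {p = outside ∷ _} x∉p = ∣p∪⁅x⁆∣≡1+∣p∣ (x∉p ∘ there)

satisfying : {P : Pred (Fin n) ℓ} → Decidable P → Subset n
satisfying P? = tabulate (isYes ∘ P?)

module _ {P : Pred (Fin n) ℓ} (P? : Decidable P) where

  ∈-satisfying⁺ : P x → x ∈ satisfying P?
  ∈-satisfying⁺ {x} px = lookup⇒[]= x _
    (trans (lookup∘tabulate _ x) (Equivalence.to T-≡ (fromWitness px)))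

  ∈-satisfying⁻ : x ∈ satisfying P? → P x
  ∈-satisfying⁻ {x} x∈ = toWitness (Equivalence.from T-≡
    (trans (sym (lookup∘tabulate _ x)) ([]=⇒lookup x∈)))

∃⟶∃-largest : {P : Pred (Fin n) ℓ} → Decidable P → ∃ P →
              ∃ λ y → P y × (∀ {u} → y <ᶠ u → ¬ P u)
∃⟶∃-largest {suc n} {P = P} P? (x , px) with any? (P? ∘ suc)
... | yes ∃P∘suc =
  let y , py , largest = ∃⟶∃-largest (P? ∘ suc) ∃P∘suc
  in suc y , py , λ { {suc u} (s≤s y<u) → largest y<u }
... | no ∄P∘suc = zero , P-zero x px , λ { {suc u} _ pu → ∄P∘suc (u , pu) }
  where
  P-zero : ∀ x → P x → P zero
  P-zero zero    px = px
  P-zero (suc x) px = ⊥-elim (∄P∘suc (x , px))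

p⊆q⇒p-x⊆q-x : p ⊆ q → p - x ⊆ q - x
p⊆q⇒p-x⊆q-x p⊆q v∈ = let v∈p , v≢x = x∈p-y⁻ v∈ in x∈p∧x≢y⇒x∈p-y (p⊆q v∈p) v≢x

p⊆q⇒p∪⁅x⁆⊆q∪⁅x⁆ : p ⊆ q → p ∪ ⁅ x ⁆ ⊆ q ∪ ⁅ x ⁆
p⊆q⇒p∪⁅x⁆⊆q∪⁅x⁆ p⊆q v∈ with x∈p∪⁅y⁆⁻ v∈
... | inj₁ v∈p = x∈p⇒x∈p∪⁅y⁆ (p⊆q v∈p)
... | inj₂ refl = x∈p∪⁅x⁆

∪⁅⁆-least : p ⊆ q → x ∈ q → p ∪ ⁅ x ⁆ ⊆ q
∪⁅⁆-least p⊆q x∈q v∈ with x∈p∪⁅y⁆⁻ v∈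
... | inj₁ v∈p = p⊆q v∈p
... | inj₂ refl = x∈q

x∈p∧x∉q-y∧x≢y⇒x∈p─q : x ∈ p → x ∉ q - y → x ≢ y → x ∈ p ─ q
x∈p∧x∉q-y∧x≢y⇒x∈p─q x∈p x∉q-y x≢y = x∈p∧x∉q⇒x∈p─q x∈p λ x∈q → x∉q-y (x∈p∧x≢y⇒x∈p-y x∈q x≢y)

p─q⊆r─[q-x] : x ∈ q → p - x ⊆ r → p ─ q ⊆ r ─ (q - x)
p─q⊆r─[q-x] {q = q} {p = p} x∈q p-x⊆r v∈ =
  x∈p∧x∉q⇒x∈p─q (p-x⊆r (x∈p∧x≢y⇒x∈p-y v∈p λ { refl → v∉q x∈q })) (v∉q ∘ proj₁ ∘ x∈p-y⁻)
  where
  v∈p = p─q⊆p p q v∈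
  v∉q = x∈p─q⇒x∉q p q v∈

replace : Subset n → Fin n → Fin n → Subset n
replace p w u = (p - w) ∪ ⁅ u ⁆

∈-replace⁻ : v ∈ replace p w u → (v ∈ p × v ≢ w) ⊎ v ≡ u
∈-replace⁻ = Sum.map₁ x∈p-y⁻ ∘ x∈p∪⁅y⁆⁻

∣replace∣≡∣p∣ : w ∈ p → u ∉ p → ∣ replace p w u ∣ ≡ ∣ p ∣
∣replace∣≡∣p∣ w∈p u∉p =
  trans (∣p∪⁅x⁆∣≡1+∣p∣ (u∉p ∘ proj₁ ∘ x∈p-y⁻)) (sym (∣p∣≡1+∣p-x∣ w∈p))

∣replace[p-x]∣<∣p∣ : x ∈ p → t ∈ p → x ≢ t → u ∉ p → ∣ replace (p - x) t u ∣ < ∣ p ∣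
∣replace[p-x]∣<∣p∣ x∈p t∈p x≢t u∉p = ≤-<-trans
  (≤-reflexive (∣replace∣≡∣p∣ (x∈p∧x≢y⇒x∈p-y t∈p (x≢t ∘ sym)) (u∉p ∘ proj₁ ∘ x∈p-y⁻)))
  (x∈p⇒∣p-x∣<∣p∣ x∈p)

replace-monoˡ : p ⊆ q → replace p w u ⊆ replace q w u
replace-monoˡ = p⊆q⇒p∪⁅x⁆⊆q∪⁅x⁆ ∘ p⊆q⇒p-x⊆q-x

replace⊆replace[p-z]∪⁅z⁆ : replace p t u ⊆ replace (p - z) t u ∪ ⁅ z ⁆
replace⊆replace[p-z]∪⁅z⁆ {z = z} {x = v} v∈ with ∈-replace⁻ v∈
... | inj₂ refl = x∈p⇒x∈p∪⁅y⁆ x∈p∪⁅x⁆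
... | inj₁ (v∈p , v≢t) with v ≟ z
...   | yes refl = x∈p∪⁅x⁆
...   | no v≢z = x∈p⇒x∈p∪⁅y⁆ (x∈p⇒x∈p∪⁅y⁆ (x∈p∧x≢y⇒x∈p-y (x∈p∧x≢y⇒x∈p-y v∈p v≢z) v≢t))

replace⊆replace[replace] : y ≢ t → replace p t y ⊆ replace (replace p z y) t z
replace⊆replace[replace] {z = z} y≢t {v} v∈ with ∈-replace⁻ v∈
... | inj₂ refl = x∈p⇒x∈p∪⁅y⁆ (x∈p∧x≢y⇒x∈p-y x∈p∪⁅x⁆ y≢t)
... | inj₁ (v∈p , v≢t) with v ≟ z
...   | yes refl = x∈p∪⁅x⁆
...   | no v≢z = x∈p⇒x∈p∪⁅y⁆ (x∈p∧x≢y⇒x∈p-y (x∈p⇒x∈p∪⁅y⁆ (x∈p∧x≢y⇒x∈p-y v∈p v≢z)) v≢t)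

replace⊆replace[p-z]∪⁅t⁆ : replace p z u ⊆ replace (p - z) t u ∪ ⁅ t ⁆
replace⊆replace[p-z]∪⁅t⁆ {p = p} {z = z} {u = u} {t = t} =
  subst (λ q → replace p z u ⊆ q ∪ ⁅ t ⁆) (cong (_∪ ⁅ u ⁆) (p─x─y≡p─y─x p t z))
        replace⊆replace[p-z]∪⁅z⁆

p-x⊆replace-y : y ∉ p → p - x ⊆ replace p x y - y
p-x⊆replace-y y∉p v∈ = x∈p∧x≢y⇒x∈p-y (x∈p⇒x∈p∪⁅y⁆ v∈) λ { refl → y∉p (proj₁ (x∈p-y⁻ v∈)) }

module _ {n : ℕ} (M : Matroid n) where
  open Matroid M

  private variable
    B D I J S Y Z : Subset n

  basis-∣≤∣ : IsBasis Indep B → IsBasis Indep D → ∣ D ∣ ≤ ∣ B ∣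
  basis-∣≤∣ (indB , maximalB) (indD , _) = ≮⇒≥ λ ∣B∣<∣D∣ →
    let v , _ , v∉B , indB∪v = indep-aug indB indD ∣B∣<∣D∣ in maximalB v v∉B indB∪v

  ∣basis∣≤⇒basis : IsBasis Indep B → Indep S → ∣ B ∣ ≤ ∣ S ∣ → IsBasis Indep S
  ∣basis∣≤⇒basis (indB , maximalB) indS ∣B∣≤∣S∣ = indS , λ u u∉S indS∪u →
    let ∣B∣<∣S∪u∣ = ≤-<-trans ∣B∣≤∣S∣ (≤-reflexive (sym (∣p∪⁅x⁆∣≡1+∣p∣ u∉S)))
        v , _ , v∉B , indB∪v = indep-aug indB indS∪u ∣B∣<∣S∪u∣
    in maximalB v v∉B indB∪v

  Exchange : Subset n → Fin n → Fin n → Set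
  Exchange B w u = u ∉ B × Indep (replace B w u)

  exchange? : ∀ B w u → Dec (Exchange B w u)
  exchange? B w u = ¬? (u ∈? B) ×-dec indep? (replace B w u)

  exchange-basis : IsBasis Indep B → w ∈ B → Exchange B w u → IsBasis Indep (replace B w u)
  exchange-basis basisB w∈B (u∉B , ind) =
    ∣basis∣≤⇒basis basisB ind (≤-reflexive (sym (∣replace∣≡∣p∣ w∈B u∉B)))

  exchange-into : IsBasis Indep B → t ∈ B → Indep D → t ∉ D → ∣ B ∣ ≤ ∣ D ∣ →
                  ∃ λ v → v ∈ D × Exchange B t v
  exchange-into {B} {t} {D} (indB , _) t∈B indD t∉D ∣B∣≤∣D∣ =
    let v , v∈D , v∉B-t , ind = indep-aug (indep-subset (p─q⊆p B ⁅ t ⁆) indB) indD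
                                          (<-≤-trans (x∈p⇒∣p-x∣<∣p∣ t∈B) ∣B∣≤∣D∣)
    in v , v∈D , (λ v∈B → v∉B-t (x∈p∧x≢y⇒x∈p-y v∈B λ v≡t → t∉D (subst (_∈ D) v≡t v∈D))) , ind

  -- B ∖ (B - x - t + u) = {x , t}, so augmenting B - x - t + u from B puts x or t back.
  exchange-for-either : IsBasis Indep B → x ∈ B → t ∈ B → x ≢ t → u ∉ B →
                        Indep (replace (B - x) t u) → Exchange B t u ⊎ Exchange B x u
  exchange-for-either {B} {x} {t} {u} (indB , _) x∈B t∈B x≢t u∉B indS
    with indep-aug indS indB (∣replace[p-x]∣<∣p∣ x∈B t∈B x≢t u∉B)
  ... | w , w∈B , w∉S , indS∪w with w ≟ x | w ≟ t
  ...   | yes refl | _        = inj₁ (u∉B , indep-subset replace⊆replace[p-z]∪⁅z⁆ indS∪w)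
  ...   | no _     | yes refl = inj₂ (u∉B , indep-subset replace⊆replace[p-z]∪⁅t⁆ indS∪w)
  ...   | no w≢x   | no w≢t   =
    ⊥-elim (w∉S (x∈p⇒x∈p∪⁅y⁆ (x∈p∧x≢y⇒x∈p-y (x∈p∧x≢y⇒x∈p-y w∈B w≢x) w≢t)))

  -- w is internally active in B iff it is the largest element of its fundamental cocircuit,
  -- i.e. iff no larger element can replace it in B.
  NoLargerExchange : Subset n → Fin n → Set
  NoLargerExchange B w = ∀ {u} → w <ᶠ u → ¬ Exchange B w u

  IA⇒noLargerExchange : IsBasis Indep B → IA M B w → NoLargerExchange B w
  IA⇒noLargerExchange {B} {w} basisB (w∈B , _ , γ , (γ-dependent , _) , γ⊆∁B∪w , (_ , γ≤w))
                      {u} w<u exchange =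
    γ-dependent (replace B w u , exchange-basis basisB w∈B exchange , x∉p⇒x∈∁p ∘ ∉replace)
    where
    ∉replace : v ∈ γ → v ∉ replace B w u
    ∉replace {v} v∈γ v∈B′ with ∈-replace⁻ v∈B′ | x∈p∪⁅y⁆⁻ (γ⊆∁B∪w v∈γ)
    ... | inj₂ refl      | _          = <⇒≱ w<u (γ≤w v v∈γ)
    ... | inj₁ (v∈B , _) | inj₁ v∈∁B = x∈∁p⇒x∉p v∈∁B v∈B
    ... | inj₁ (_ , v≢w) | inj₂ v≡w  = v≢w v≡w

  fundamentalCocircuit : Subset n → Fin n → Subset n
  fundamentalCocircuit B w = satisfying λ u → (u ≟ w) ⊎-dec exchange? B w u

  module _ {B : Subset n} {w : Fin n} where

    ∈-fundamentalCocircuit⁺ : u ≡ w ⊎ Exchange B w u → u ∈ fundamentalCocircuit B w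
    ∈-fundamentalCocircuit⁺ = ∈-satisfying⁺ _

    ∈-fundamentalCocircuit⁻ : u ∈ fundamentalCocircuit B w → u ≡ w ⊎ Exchange B w u
    ∈-fundamentalCocircuit⁻ = ∈-satisfying⁻ _

    fundamentalCocircuit∩B⊆⁅w⁆ : u ∈ fundamentalCocircuit B w → u ∈ B → u ≡ w
    fundamentalCocircuit∩B⊆⁅w⁆ u∈γ u∈B with ∈-fundamentalCocircuit⁻ u∈γ
    ... | inj₁ u≡w       = u≡w
    ... | inj₂ (u∉B , _) = ⊥-elim (u∉B u∈B)

    fundamentalCocircuit⊆∁B∪⁅w⁆ : fundamentalCocircuit B w ⊆ ∁ B ∪ ⁅ w ⁆
    fundamentalCocircuit⊆∁B∪⁅w⁆ u∈γ with ∈-fundamentalCocircuit⁻ u∈γ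
    ... | inj₁ refl      = x∈p∪⁅x⁆
    ... | inj₂ (u∉B , _) = x∈p⇒x∈p∪⁅y⁆ (x∉p⇒x∈∁p u∉B)

    fundamentalCocircuit-isCircuit : IsBasis Indep B → w ∈ B →
                                     IsCircuit (DualIndep M) (fundamentalCocircuit B w)
    fundamentalCocircuit-isCircuit basisB w∈B = dependent , minimal
      where
      γ = fundamentalCocircuit B w

      dependent : ¬ DualIndep M γ
      dependent (B₀ , basisB₀ , γ⊆∁B₀) =
        let w∉B₀ = x∈∁p⇒x∉p (γ⊆∁B₀ (∈-fundamentalCocircuit⁺ (inj₁ refl)))
            v , v∈B₀ , exchange = exchange-into basisB w∈B (proj₁ basisB₀) w∉B₀
                                                (basis-∣≤∣ basisB₀ basisB)
        in x∈∁p⇒x∉p (γ⊆∁B₀ (∈-fundamentalCocircuit⁺ (inj₂ exchange))) v∈B₀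

      minimal : ∀ v → v ∈ γ → DualIndep M (γ - v)
      minimal v v∈γ with ∈-fundamentalCocircuit⁻ v∈γ
      ... | inj₁ refl = B , basisB , λ t∈ → x∉p⇒x∈∁p λ t∈B →
        let t∈γ , t≢w = x∈p-y⁻ t∈ in t≢w (fundamentalCocircuit∩B⊆⁅w⁆ t∈γ t∈B)
      ... | inj₂ exchange = replace B w v , exchange-basis basisB w∈B exchange ,
                            λ t∈ → x∉p⇒x∈∁p (∉replace t∈)
        where
        ∉replace : t ∈ γ - v → t ∉ replace B w v
        ∉replace t∈ t∈B′ with x∈p-y⁻ t∈ | ∈-replace⁻ t∈B′
        ... | _ , t≢v   | inj₂ t≡v         = t≢v t≡v
        ... | t∈γ , _   | inj₁ (t∈B , t≢w) = t≢w (fundamentalCocircuit∩B⊆⁅w⁆ t∈γ t∈B)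

  noLargerExchange⇒IA : IsBasis Indep B → w ∈ B → NoLargerExchange B w → IA M B w
  noLargerExchange⇒IA {B} {w} basisB w∈B noLarger =
    w∈B , x∈p⇒x∉∁p w∈B , fundamentalCocircuit B w ,
    fundamentalCocircuit-isCircuit basisB w∈B , fundamentalCocircuit⊆∁B∪⁅w⁆ ,
    (∈-fundamentalCocircuit⁺ (inj₁ refl) , γ≤w)
    where
    γ≤w : ∀ u → u ∈ fundamentalCocircuit B w → u ≤ᶠ w
    γ≤w u u∈γ with ∈-fundamentalCocircuit⁻ u∈γ
    ... | inj₁ refl     = ≤-refl
    ... | inj₂ exchange = ≮⇒≥ λ w<u → noLarger w<u exchange

  -- B - x + y is the related basis of I - x when x is not internally active in B.
  module LargestExchange {B : Subset n} {x y : Fin n} (basisB : IsBasis Indep B) (x∈B : x ∈ B)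
    (x<y : x <ᶠ y) (exchange : Exchange B x y) (largest : ∀ {u} → y <ᶠ u → ¬ Exchange B x u)
    where

    B′ : Subset n
    B′ = replace B x y

    basisB′ : IsBasis Indep B′
    basisB′ = exchange-basis basisB x∈B exchange

    B-x⊆B′ : B - x ⊆ B′
    B-x⊆B′ = x∈p⇒x∈p∪⁅y⁆

    ∉B′⇒∉B : u ∉ B′ → u ≢ x → u ∉ B
    ∉B′⇒∉B u∉B′ u≢x u∈B = u∉B′ (B-x⊆B′ (x∈p∧x≢y⇒x∈p-y u∈B u≢x))

    y-active : IA M B′ y
    y-active = noLargerExchange⇒IA basisB′ x∈p∪⁅x⁆ λ y<u (u∉B′ , ind) →
      largest y<u ( ∉B′⇒∉B u∉B′ (λ { refl → <-asym x<y y<u })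
                  , indep-subset (p⊆q⇒p∪⁅x⁆⊆q∪⁅x⁆ (p-x⊆replace-y (proj₁ exchange))) ind)

    module _ {t : Fin n} (t∈B : t ∈ B) (t≢x : t ≢ x) (t-active : IA M B t) where

      private
        noLarger : NoLargerExchange B t
        noLarger = IA⇒noLargerExchange basisB t-active

        t∈B′ : t ∈ B′
        t∈B′ = B-x⊆B′ (x∈p∧x≢y⇒x∈p-y t∈B t≢x)

        t∉replace : t <ᶠ u → t ∉ replace B′ t u
        t∉replace t<u t∈ with ∈-replace⁻ t∈
        ... | inj₁ (_ , t≢t) = t≢t refl
        ... | inj₂ refl      = <-irrefl refl t<u

        y≤t : t <ᶠ u → Exchange B′ t u → y ≤ᶠ t
        y≤t t<u (u∉B′ , ind)
          with exchange-into basisB t∈B ind (t∉replace t<u)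
                             (basis-∣≤∣ (exchange-basis basisB′ t∈B′ (u∉B′ , ind)) basisB)
        ... | v , v∈D , exchange′ with ∈-replace⁻ v∈D
        ...   | inj₂ refl = ⊥-elim (noLarger t<u exchange′)
        ...   | inj₁ (v∈B′ , _) with ∈-replace⁻ v∈B′
        ...     | inj₁ (v∈B , _) = ⊥-elim (proj₁ exchange′ v∈B)
        ...     | inj₂ refl      = ≮⇒≥ λ t<y → noLarger t<y exchange′

        u≤y : t <ᶠ u → u ≢ x → Exchange B′ t u → u ≤ᶠ y
        u≤y t<u u≢x (u∉B′ , ind)
          with exchange-for-either basisB x∈B t∈B (t≢x ∘ sym) (∉B′⇒∉B u∉B′ u≢x)
                                   (indep-subset (replace-monoˡ B-x⊆B′) ind)
        ... | inj₁ exchange′ = ⊥-elim (noLarger t<u exchange′)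
        ... | inj₂ exchange′ = ≮⇒≥ λ y<u → largest y<u exchange′

        noLarger′ : NoLargerExchange B′ t
        noLarger′ {u} t<u exchange′ with u ≟ x
        ... | yes refl = noLarger (<-trans t<u x<y)
          (proj₁ exchange , indep-subset (replace⊆replace[replace] λ { refl → proj₁ exchange t∈B })
                                         (proj₂ exchange′))
        ... | no u≢x = <⇒≱ t<u (≤-trans (u≤y t<u u≢x exchange′) (y≤t t<u exchange′))

      active-preserved : IA M B′ t
      active-preserved = noLargerExchange⇒IA basisB′ t∈B′ noLarger′

  relatedBasis-remove : RelBasis M I B → x ∈ I →
                        ∃ λ B′ → RelBasis M (I - x) B′ × B ─ I ⊆ B′ ─ (I - x)
  relatedBasis-remove {I} {B} {x} (basisB , I⊆B , active) x∈I
    with any? (λ u → (x <? u) ×-dec exchange? B x u)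
  ... | no ∄larger =
    B , (basisB , ⊆-trans (p─q⊆p I ⁅ x ⁆) I⊆B , active′) , p─q⊆r─[q-x] x∈I (p─q⊆p B ⁅ x ⁆)
    where
    active′ : ∀ t → t ∈ B ─ (I - x) → IA M B t
    active′ t t∈ with t ≟ x
    ... | yes refl = noLargerExchange⇒IA basisB (I⊆B x∈I) λ x<u e → ∄larger (_ , x<u , e)
    ... | no t≢x   =
      active t (x∈p∧x∉q-y∧x≢y⇒x∈p─q (p─q⊆p B (I - x) t∈) (x∈p─q⇒x∉q B (I - x) t∈) t≢x)
  ... | yes (u , x<u , exchangeU) with ∃⟶∃-largest (exchange? B x) (u , exchangeU)
  ... | y , exchangeY , largest =
    B′ , (basisB′ , B-x⊆B′ ∘ p⊆q⇒p-x⊆q-x I⊆B , active′) , p─q⊆r─[q-x] x∈I B-x⊆B′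
    where
    open LargestExchange basisB (I⊆B x∈I) (<-≤-trans x<u (≮⇒≥ λ y<u → largest y<u exchangeU))
                         exchangeY largest
    active′ : ∀ t → t ∈ B′ ─ (I - x) → IA M B′ t
    active′ t t∈ with ∈-replace⁻ (p─q⊆p B′ (I - x) t∈)
    ... | inj₂ refl        = y-active
    ... | inj₁ (t∈B , t≢x) =
      active-preserved t∈B t≢x (active t (x∈p∧x∉q-y∧x≢y⇒x∈p─q t∈B (x∈p─q⇒x∉q B′ (I - x) t∈) t≢x))

  nbc-⊆ : J ⊆ I → IsNBC M I → IsNBC M J
  nbc-⊆ {J} {I} J⊆I (indI , noEA) = indep-subset J⊆I indI , noEA′
    where
    noEA′ : ∀ e → ¬ EA M J e
    noEA′ e (_ , γ , circuit , γ⊆J∪e , max) with e ∈? I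
    ... | yes e∈I =
      proj₁ circuit (indep-subset (λ v∈γ → ∪⁅⁆-least J⊆I e∈I (γ⊆J∪e v∈γ)) indI)
    ... | no e∉I  =
      noEA e (e∉I , γ , circuit , (λ v∈γ → p⊆q⇒p∪⁅x⁆⊆q∪⁅x⁆ J⊆I (γ⊆J∪e v∈γ)) , max)

  IA-antitone : J ⊆ I → w ∈ J → IA M I w → IA M J w
  IA-antitone J⊆I w∈J (_ , _ , γ , circuit , γ⊆∁I∪w , max) =
    w∈J , x∈p⇒x∉∁p w∈J , γ , circuit ,
    (λ v∈γ → p⊆q⇒p∪⁅x⁆⊆q∪⁅x⁆ (p⊆q⇒∁p⊇∁q J⊆I) (γ⊆∁I∪w v∈γ)) , max

  InKey-mono : IsNBC M J → J ⊆ I → ∀ e → InKey M J e → InKey M I e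
  InKey-mono _            J⊆I e (inj₁ (e∈J , ¬IA)) = inj₁ (J⊆I e∈J , ¬IA ∘ IA-antitone J⊆I e∈J)
  InKey-mono (_ , noEA) _   e (inj₂ ea)          = ⊥-elim (noEA e ea)

  -- ¬¬ only because IntRelated is not decided; every use has a negative goal.
  ⊆⇒¬¬≤ext/int : IsNBC M J → J ⊆ I → ¬ ¬ (_≤ext/int_ {M = M} J I)
  ⊆⇒¬¬≤ext/int {J} {I} nbcJ J⊆I = ¬¬-map decide≤ ¬¬-excluded-middle
    where
    decide≤ : Dec (IntRelated M J I) → _≤ext/int_ {M = M} J I
    decide≤ (yes related)  = inj₂ (related , J⊆I)
    decide≤ (no unrelated) = inj₁ (unrelated , InKey-mono nbcJ J⊆I)

  InFacet-remove : RelBasis M I B → (Y , Z) ⊆F G B I → x ∈ I → x ∉ Z →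
                   InFacet M (Y , Z) (I - x)
  InFacet-remove relB (Y⊆B─I , Z⊆I) x∈I x∉Z =
    let B′ , relB′ , B─I⊆ = relatedBasis-remove relB x∈I
    in B′ , relB′ , (λ v∈Y → B─I⊆ (Y⊆B─I v∈Y)) ,
       λ v∈Z → x∈p∧x≢y⇒x∈p-y (Z⊆I v∈Z) λ { refl → x∉Z v∈Z }

  module _ {_≺_ : Subset n → Subset n → Set} (linear : IsLinExtNBC M _≺_) where
    open IsLinExtNBC linear renaming (trans to ≺-trans)

    ⊆⇒⊀ : IsNBC M J → IsNBC M I → J ⊆ I → ¬ (I ≺ J)
    ⊆⇒⊀ {J} {I} nbcJ nbcI J⊆I I≺J with ≡-dec _≟ᵇ_ J I
    ... | yes refl = irrefl I nbcI I≺J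
    ... | no J≢I   = ⊆⇒¬¬≤ext/int nbcJ J⊆I λ J≤I →
      irrefl I nbcI (≺-trans I J I nbcI nbcJ nbcI I≺J (extends J I nbcJ nbcI J≢I J≤I))

    remove-≺ : IsNBC M I → x ∈ I → ¬ ¬ ((I - x) ≺ I)
    remove-≺ {I = I} {x = x} nbcI x∈I =
      ¬¬-map (extends (I - x) I nbcI-x nbcI I-x≢I) (⊆⇒¬¬≤ext/int nbcI-x (p─q⊆p I ⁅ x ⁆))
      where
      nbcI-x = nbc-⊆ (p─q⊆p I ⁅ x ⁆) nbcI
      I-x≢I : I - x ≢ I
      I-x≢I I-x≡I = proj₂ (x∈p-y⁻ (subst (x ∈_) (sym I-x≡I) x∈I)) refl

    zFace⊆⇒notInEarlierFacet : IsNBC M I → zFace I ⊆F (Y , Z) →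
      ∀ J → IsNBC M J → J ≺ I → ¬ InFacet M (Y , Z) J
    zFace⊆⇒notInEarlierFacet nbcI (_ , I⊆Z) J nbcJ J≺I (_ , _ , _ , Z⊆J) =
      ⊆⇒⊀ nbcI nbcJ (λ v∈I → Z⊆J (I⊆Z v∈I)) J≺I

    notInEarlierFacet⇒zFace⊆ : IsNBC M I → RelBasis M I B → (Y , Z) ⊆F G B I →
      (∀ J → IsNBC M J → J ≺ I → ¬ InFacet M (Y , Z) J) → zFace I ⊆F (Y , Z)
    notInEarlierFacet⇒zFace⊆ {I} {Z = Z} nbcI relB A⊆G notInEarlier =
      ⊥⊆ , λ {x} x∈I → decidable-stable (x ∈? Z) λ x∉Z →
        remove-≺ nbcI x∈I λ I-x≺I →
          notInEarlier (I - x) (nbc-⊆ (p─q⊆p I ⁅ x ⁆) nbcI) I-x≺I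
                       (InFacet-remove relB A⊆G x∈I x∉Z)

corollary7p4 : ∀ {n : ℕ} (M : Matroid n) (_≺_ : Subset n → Subset n → Set) →
    IsLinExtNBC M _≺_ →
    ∀ I → IsNBC M I → ∀ B → RelBasis M I B →
    IsRestrictionSet M _≺_ B I (zFace I)
corollary7p4 M _≺_ linear I nbcI B relB = (⊥⊆ , ⊆-refl) , λ { (Y , Z) A⊆G →
  zFace⊆⇒notInEarlierFacet M linear nbcI , notInEarlierFacet⇒zFace⊆ M linear nbcI relB A⊆G }
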